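{- For every $n\ge0$, $$P_n(t)=\sum_{T\in\mathcal T_n}t^{\mathrm{emp}(T)},\qquad Q_n(t)=\sum_{T\in\mathcal T^*_n}t^{\mathrm{emp}(T)-1}.$$
   Context: $P_n(t)$ and $Q_n(t)$ are the polynomials with $\frac{d^n}{dx^n}\tan x=P_n(\tan x)$ and $\frac{d^n}{dx^n}\sec x=Q_n(\tan x)\sec x$. $\mathcal T_n$ is the set of complete binary plane trees (each internal node has exactly two ordered children) in which every node is labelled by an integer except some leaves which are unlabelled (empty leaves), each $i\in\{1,\dots,n\}$ is used exactly once as a label, and labels increase along every path from the root to a leaf. $\mathrm{emp}(T)$ is the number of empty leaves of $T$, and $\mathcal T^*_n\subseteq\mathcal T_n$ is the subset of trees whose rightmost leaf is empty. -}

module Defs where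

open import Data.Nat using (ℕ; zero; suc; _+_; _*_; _∸_; _<_; _≟_)
open import Data.List using (List; []; _∷_; _++_; map; upTo)
open import Data.List.Relation.Unary.All using (All)
open import Data.List.Relation.Binary.Permutation.Propositional using (_↭_)
open import Data.Product using (_×_)
open import Data.Unit using (⊤)
open import Data.Empty using (⊥)
open import Relation.Nullary using (yes; no)
open import Data.List.Relation.Unary.Unique.Propositional using (Unique)
open import Data.List.Membership.Propositional using (_∈_)
open import Function.Bundles using (_⇔_)

-- Polynomials in t with natural-number coefficients, represented by
-- their coefficient functions (coefficient of t^k is  p k ).

Poly : Set
Poly = ℕ → ℕ

X : Poly
X zero          = 0
X (suc zero)    = 1
X (suc (suc _)) = 0

one : Poly
one zero    = 1
one (suc _) = 0

_⊕_ : Poly → Poly → Poly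
(p ⊕ q) k = p k + q k

mulX : Poly → Poly
mulX p zero    = 0
mulX p (suc k) = p k

deriv : Poly → Poly
deriv p k = suc k * p (suc k)

mul1+X² : Poly → Poly
mul1+X² p = p ⊕ mulX (mulX p)

monomial : ℕ → Poly
monomial e k with e ≟ k
... | yes _ = 1
... | no  _ = 0

-- Derivative polynomials (chain rule, with  tan' = 1 + tan^2,
-- sec' = tan · sec):
--   d^n/dx^n tan x = P n (tan x),   d^n/dx^n sec x = Q n (tan x) sec x
--   P 0 = t,  P (n+1) = (1 + t^2) P n'
--   Q 0 = 1,  Q (n+1) = (1 + t^2) Q n' + t Q n

P : ℕ → Poly
P zero    = X
P (suc n) = mul1+X² (deriv (P n))

Q : ℕ → Poly
Q zero    = one
Q (suc n) = mul1+X² (deriv (Q n)) ⊕ mulX (Q n)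

-- Complete binary plane trees; internal nodes are labelled, leaves are
-- either labelled or empty (unlabelled).

data Tree : Set where
  empty : Tree
  leaf  : ℕ → Tree
  node  : ℕ → Tree → Tree → Tree

labels : Tree → List ℕ
labels empty        = []
labels (leaf a)     = a ∷ []
labels (node a l r) = a ∷ (labels l ++ labels r)

emp : Tree → ℕ
emp empty        = 1
emp (leaf _)     = 0
emp (node _ l r) = emp l + emp r

Increasing : Tree → Set
Increasing empty        = ⊤
Increasing (leaf _)     = ⊤
Increasing (node a l r) =
  All (a <_) (labels l) × All (a <_) (labels r) × Increasing l × Increasing r

RightmostEmpty : Tree → Set
RightmostEmpty empty        = ⊤
RightmostEmpty (leaf _)     = ⊥
RightmostEmpty (node _ _ r) = RightmostEmpty r

InT : ℕ → Tree → Set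
InT n T = (labels T ↭ map suc (upTo n)) × Increasing T

InT* : ℕ → Tree → Set
InT* n T = InT n T × RightmostEmpty T

polySum : (Tree → ℕ) → List Tree → Poly
polySum f []       k = 0
polySum f (T ∷ xs) k = monomial (f T) k + polySum f xs k

Enumerates : List Tree → (Tree → Set) → Set
Enumerates xs S = Unique xs × (∀ T → (T ∈ xs) ⇔ S T)

-- Deleting the largest label n + 1 from a tree of 𝒯_{n+1} leaves a tree of 𝒯_n in which it had
-- occupied an empty leaf, either as a labelled leaf or as a node with two empty leaves.  Hence
-- 𝒯_{n+1} is the disjoint union, over T ∈ 𝒯_n, of the 2·emp(T) trees obtained by these two kinds of
-- insertion, with emp(T) ∓ 1 empty leaves: the monomial t^e turns into e(t^(e-1) + t^(e+1)),
-- which is (1 + t²)(t^e)′, the recurrence of P.  In 𝒯*_n the rightmost empty leaf may only become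
-- a node; weighting by emp − 1 the monomial t^e then turns into (1 + t²)(t^e)′ + t·t^e, the
-- recurrence of Q.  Both sums are invariant under reordering, so any enumeration will do.

module Submission where

open import Defs
open import Data.Bool using (if_then_else_)
open import Data.Nat using (ℕ; zero; suc; _+_; _*_; _∸_; _≤_; _<_; s≤s)
open import Data.Nat.Properties
open import Data.Nat.ListAction using (sum)
open import Data.Nat.ListAction.Properties using (sum-++; sum-↭)
open import Algebra.Properties.CommutativeSemigroup +-commutativeSemigroup using (interchange; xy∙z≈y∙xz)
open import Data.List using (List; []; _∷_; _++_; map; concatMap; upTo; applyUpTo)
open import Data.List.Properties using (map-++; map-upTo; applyUpTo-∷ʳ)
open import Data.Product using (_×_; _,_; ∃; proj₁; proj₂)
open import Data.Sum using (_⊎_; inj₁; inj₂)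
open import Data.Empty using (⊥-elim)
open import Data.Unit using (tt)
open import Function.Base using (_∘_)
open import Function.Bundles using (mk⇔; Equivalence)
open import Relation.Nullary using (¬_; does; yes; no)
open import Relation.Nullary.Decidable using (dec-true; dec-false)
open import Relation.Binary.PropositionalEquality
open import Data.List.Membership.Propositional using (_∈_; _∉_; find; lose)
open import Data.List.Membership.Propositional.Properties
  using (∈-++⁻; ∈-++⁺ˡ; ∈-++⁺ʳ; ∈-map⁺; ∈-map⁻; ∈-concatMap⁺; ∈-concatMap⁻)
open import Data.List.Membership.Propositional.Properties.WithK using (unique∧set⇒bag)
open import Data.List.Relation.Unary.Any using (here; there)
open import Data.List.Relation.Unary.All as All using (All; []; _∷_)
open import Data.List.Relation.Unary.All.Properties using (++⁻ˡ; ++⁻ʳ; applyUpTo⁺₁)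
open import Data.List.Relation.Unary.AllPairs using ([]; _∷_)
open import Data.List.Relation.Unary.Unique.Propositional using (Unique)
import Data.List.Relation.Unary.Unique.Propositional.Properties as Unique
open import Data.List.Relation.Binary.Permutation.Propositional using (_↭_; prep; swap; ↭-sym; ↭-trans; ↭-refl)
import Data.List.Relation.Binary.Permutation.Propositional.Properties as ↭
open import Data.List.Relation.Binary.Permutation.Propositional.Properties
  using (All-resp-↭; ∈-resp-↭; drop-∷; ∷↭∷ʳ; ↭-length; shift; ↭-empty-inv; ++⁺ˡ; ++⁺ʳ)
open import Data.List.Relation.Binary.BagAndSetEquality using (∼bag⇒↭)

monomial-suc : ∀ e k → monomial (suc e) (suc k) ≡ monomial e k
monomial-suc e k with e ≟ k | suc e ≟ suc k
... | yes _   | yes _   = refl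
... | no _    | no _    = refl
... | yes e≡k | no e≢k  = ⊥-elim (e≢k (cong suc e≡k))
... | no e≢k  | yes e≡k = ⊥-elim (e≢k (suc-injective e≡k))

monomial-zero : ∀ e → monomial (suc e) zero ≡ 0
monomial-zero e with suc e ≟ zero
... | no _ = refl

*-monomial-cong : ∀ e k {x y} → (e ≡ k → x ≡ y) → x * monomial e k ≡ y * monomial e k
*-monomial-cong e k {x} {y} x≡y with e ≟ k
... | yes e≡k = cong (_* 1) (x≡y e≡k)
... | no _    = trans (*-zeroʳ x) (sym (*-zeroʳ y))

infix 25 _·_
_·_ : ℕ → Poly → Poly
(c · p) k = c * p k

spread : ℕ → Poly
spread e = monomial (e ∸ 1) ⊕ monomial (suc e)

record Additive (Φ : Poly → Poly) : Set where
  field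
    resp-≗ : ∀ {p q} → p ≗ q → Φ p ≗ Φ q
    map-0  : Φ (λ _ → 0) ≗ λ _ → 0
    map-⊕  : ∀ p q → Φ (p ⊕ q) ≗ Φ p ⊕ Φ q

open Additive

⊕-additive : ∀ {Φ Ψ} → Additive Φ → Additive Ψ → Additive (λ p → Φ p ⊕ Ψ p)
⊕-additive {Φ} {Ψ} Φ-add Ψ-add = record
  { resp-≗ = λ p≗q k → cong₂ _+_ (resp-≗ Φ-add p≗q k) (resp-≗ Ψ-add p≗q k)
  ; map-0  = λ k → cong₂ _+_ (map-0 Φ-add k) (map-0 Ψ-add k)
  ; map-⊕  = λ p q k → trans (cong₂ _+_ (map-⊕ Φ-add p q k) (map-⊕ Ψ-add p q k))
                             (interchange (Φ p k) (Φ q k) (Ψ p k) (Ψ q k))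
  }

mulX-additive : Additive mulX
mulX-additive = record
  { resp-≗ = λ { p≗q zero → refl ; p≗q (suc k) → p≗q k }
  ; map-0  = λ { zero → refl ; (suc k) → refl }
  ; map-⊕  = λ { p q zero → refl ; p q (suc k) → refl }
  }

mulX-monomial : ∀ e → mulX (monomial e) ≗ monomial (suc e)
mulX-monomial e zero    = sym (monomial-zero e)
mulX-monomial e (suc k) = sym (monomial-suc e k)

∂tan : Poly → Poly
∂tan p = mul1+X² (deriv p)

∂sec : Poly → Poly
∂sec p = ∂tan p ⊕ mulX p

∂tan-coeff : ∀ p k → ∂tan p k ≡ suc k * p (suc k) + (k ∸ 1) * p (k ∸ 1)
∂tan-coeff p zero          = refl
∂tan-coeff p (suc zero)    = refl
∂tan-coeff p (suc (suc k)) = refl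

∂tan-additive : Additive ∂tan
∂tan-additive = record
  { resp-≗ = λ {p} {q} p≗q k → begin
      ∂tan p k                                   ≡⟨ ∂tan-coeff p k ⟩
      suc k * p (suc k) + (k ∸ 1) * p (k ∸ 1)    ≡⟨ cong₂ (λ u v → suc k * u + (k ∸ 1) * v)
                                                           (p≗q (suc k)) (p≗q (k ∸ 1)) ⟩
      suc k * q (suc k) + (k ∸ 1) * q (k ∸ 1)    ≡⟨ ∂tan-coeff q k ⟨
      ∂tan q k                                   ∎
  ; map-0  = λ k → trans (∂tan-coeff (λ _ → 0) k) (cong₂ _+_ (*-zeroʳ (suc k)) (*-zeroʳ (k ∸ 1)))
  ; map-⊕  = λ p q k → let a = suc k ; b = k ∸ 1 in begin
      ∂tan (p ⊕ q) k
        ≡⟨ ∂tan-coeff (p ⊕ q) k ⟩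
      a * (p (suc k) + q (suc k)) + b * (p (k ∸ 1) + q (k ∸ 1))
        ≡⟨ cong₂ _+_ (*-distribˡ-+ a (p (suc k)) (q (suc k))) (*-distribˡ-+ b (p (k ∸ 1)) (q (k ∸ 1))) ⟩
      (a * p (suc k) + a * q (suc k)) + (b * p (k ∸ 1) + b * q (k ∸ 1))
        ≡⟨ interchange (a * p (suc k)) (a * q (suc k)) (b * p (k ∸ 1)) (b * q (k ∸ 1)) ⟩
      (a * p (suc k) + b * p (k ∸ 1)) + (a * q (suc k) + b * q (k ∸ 1))
        ≡⟨ cong₂ _+_ (∂tan-coeff p k) (∂tan-coeff q k) ⟨
      ∂tan p k + ∂tan q k
        ∎
  }
  where open ≡-Reasoning

∂sec-additive : Additive ∂sec
∂sec-additive = ⊕-additive ∂tan-additive mulX-additive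

∂tan-monomial : ∀ e → ∂tan (monomial e) ≗ e · spread e
∂tan-monomial e k = begin
  ∂tan (monomial e) k                                         ≡⟨ ∂tan-coeff (monomial e) k ⟩
  suc k * monomial e (suc k) + (k ∸ 1) * monomial e (k ∸ 1)   ≡⟨ cong₂ _+_ (*-monomial-cong e (suc k) sym)
                                                                             (*-monomial-cong e (k ∸ 1) sym) ⟩
  e * monomial e (suc k) + e * monomial e (k ∸ 1)             ≡⟨ cong₂ _+_ (lower e) (raise e k) ⟩
  e * monomial (e ∸ 1) k + e * monomial (suc e) k             ≡⟨ *-distribˡ-+ e _ _ ⟨
  (e · spread e) k                                            ∎
  where
  open ≡-Reasoning
  lower : ∀ e → e * monomial e (suc k) ≡ e * monomial (e ∸ 1) k
  lower zero    = refl
  lower (suc e) = cong (suc e *_) (monomial-suc e k)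
  raise : ∀ e k → e * monomial e (k ∸ 1) ≡ e * monomial (suc e) k
  raise zero    k       = refl
  raise (suc e) zero    = cong (suc e *_) (trans (monomial-zero e) (sym (monomial-zero (suc e))))
  raise (suc e) (suc k) = cong (suc e *_) (sym (monomial-suc (suc e) k))

∂sec-monomial : ∀ e → ∂sec (monomial e) ≗ e · spread e ⊕ monomial (suc e)
∂sec-monomial e k = cong₂ _+_ (∂tan-monomial e k) (mulX-monomial e k)

polySum-sum : ∀ f xs k → polySum f xs k ≡ sum (map (λ T → monomial (f T) k) xs)
polySum-sum f []       k = refl
polySum-sum f (T ∷ xs) k = cong (monomial (f T) k +_) (polySum-sum f xs k)

polySum-++ : ∀ f xs ys → polySum f (xs ++ ys) ≗ polySum f xs ⊕ polySum f ys
polySum-++ f xs ys k = begin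
  polySum f (xs ++ ys) k                          ≡⟨ polySum-sum f (xs ++ ys) k ⟩
  sum (map g (xs ++ ys))                          ≡⟨ cong sum (map-++ g xs ys) ⟩
  sum (map g xs ++ map g ys)                      ≡⟨ sum-++ (map g xs) (map g ys) ⟩
  sum (map g xs) + sum (map g ys)                 ≡⟨ cong₂ _+_ (polySum-sum f xs k) (polySum-sum f ys k) ⟨
  polySum f xs k + polySum f ys k                 ∎
  where
  open ≡-Reasoning
  g = λ T → monomial (f T) k

polySum-↭ : ∀ f {xs ys} → xs ↭ ys → polySum f xs ≗ polySum f ys
polySum-↭ f {xs} {ys} xs↭ys k = begin
  polySum f xs k     ≡⟨ polySum-sum f xs k ⟩
  sum (map g xs)     ≡⟨ sum-↭ (↭.map⁺ g xs↭ys) ⟩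
  sum (map g ys)     ≡⟨ polySum-sum f ys k ⟨
  polySum f ys k     ∎
  where
  open ≡-Reasoning
  g = λ T → monomial (f T) k

polySum-map : ∀ f (h : Tree → Tree) xs → polySum f (map h xs) ≗ polySum (λ T → f (h T)) xs
polySum-map f h []       k = refl
polySum-map f h (T ∷ xs) k = cong (monomial (f (h T)) k +_) (polySum-map f h xs k)

polySum-cong : ∀ {f g} xs → (∀ {T} → T ∈ xs → f T ≡ g T) → polySum f xs ≗ polySum g xs
polySum-cong []       f≡g k = refl
polySum-cong (T ∷ xs) f≡g k =
  cong₂ _+_ (cong (λ e → monomial e k) (f≡g (here refl))) (polySum-cong xs (λ T∈xs → f≡g (there T∈xs)) k)

polySum-concatMap : ∀ {Φ} → Additive Φ → ∀ w v (f : Tree → List Tree) xs →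
  All (λ T → polySum w (f T) ≗ Φ (monomial (v T))) xs →
  polySum w (concatMap f xs) ≗ Φ (polySum v xs)
polySum-concatMap Φ-add w v f []       []         k = sym (map-0 Φ-add k)
polySum-concatMap {Φ} Φ-add w v f (T ∷ xs) (wT ∷ wxs) k = begin
  polySum w (f T ++ concatMap f xs) k                    ≡⟨ polySum-++ w (f T) (concatMap f xs) k ⟩
  polySum w (f T) k + polySum w (concatMap f xs) k       ≡⟨ cong₂ _+_ (wT k) (polySum-concatMap Φ-add w v f xs wxs k) ⟩
  Φ (monomial (v T)) k + Φ (polySum v xs) k              ≡⟨ map-⊕ Φ-add (monomial (v T)) (polySum v xs) k ⟨
  Φ (polySum v (T ∷ xs)) k                               ∎
  where open ≡-Reasoning

branches : ℕ → Tree → Tree → List Tree → List Tree → List Tree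
branches a l r xs ys = map (λ l′ → node a l′ r) xs ++ map (node a l) ys

∈-branches⁻ : ∀ {a l r T} xs ys → T ∈ branches a l r xs ys →
  (∃ λ l′ → l′ ∈ xs × T ≡ node a l′ r) ⊎ (∃ λ r′ → r′ ∈ ys × T ≡ node a l r′)
∈-branches⁻ xs ys T∈ with ∈-++⁻ (map _ xs) T∈
... | inj₁ T∈ˡ = inj₁ (∈-map⁻ _ T∈ˡ)
... | inj₂ T∈ʳ = inj₂ (∈-map⁻ _ T∈ʳ)

∈-branchesˡ : ∀ {a l r xs ys l′} → l′ ∈ xs → node a l′ r ∈ branches a l r xs ys
∈-branchesˡ l′∈ = ∈-++⁺ˡ (∈-map⁺ _ l′∈)

∈-branchesʳ : ∀ {a l r xs ys r′} → r′ ∈ ys → node a l r′ ∈ branches a l r xs ys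
∈-branchesʳ {xs = xs} r′∈ = ∈-++⁺ʳ (map _ xs) (∈-map⁺ _ r′∈)

branches-unique : ∀ {a l r xs ys} → Unique xs → Unique ys → r ∉ ys → Unique (branches a l r xs ys)
branches-unique xs! ys! r∉ys =
  Unique.++⁺ (Unique.map⁺ node-injectiveˡ xs!) (Unique.map⁺ node-injectiveʳ ys!) disjoint
  where
  node-injectiveˡ : ∀ {a l l′ r} → node a l r ≡ node a l′ r → l ≡ l′
  node-injectiveˡ refl = refl
  node-injectiveʳ : ∀ {a l r r′} → node a l r ≡ node a l r′ → r ≡ r′
  node-injectiveʳ refl = refl
  disjoint : ∀ {T} → ¬ (T ∈ map _ _ × T ∈ map _ _)
  disjoint (T∈ˡ , T∈ʳ) with ∈-map⁻ _ T∈ˡ | ∈-map⁻ _ T∈ʳ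
  ... | _ , _ , refl | _ , r∈ys , refl = r∉ys r∈ys

insertions : ℕ → Tree → List Tree
insertions m empty        = leaf m ∷ node m empty empty ∷ []
insertions m (leaf _)     = []
insertions m (node a l r) = branches a l r (insertions m l) (insertions m r)

insertions* : ℕ → Tree → List Tree
insertions* m empty        = node m empty empty ∷ []
insertions* m (leaf _)     = []
insertions* m (node a l r) = branches a l r (insertions m l) (insertions* m r)

insertions*⊆insertions : ∀ m T₀ {T} → T ∈ insertions* m T₀ → T ∈ insertions m T₀
insertions*⊆insertions m empty (here refl) = there (here refl)
insertions*⊆insertions m (node a l r) T∈ with ∈-branches⁻ (insertions m l) (insertions* m r) T∈
... | inj₁ (l′ , l′∈ , refl) = ∈-branchesˡ l′∈
... | inj₂ (r′ , r′∈ , refl) = ∈-branchesʳ (insertions*⊆insertions m r r′∈)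

insertions-labels : ∀ m T₀ {T} → T ∈ insertions m T₀ → labels T ↭ m ∷ labels T₀
insertions-labels m empty (here refl)         = ↭-refl
insertions-labels m empty (there (here refl)) = ↭-refl
insertions-labels m (node a l r) T∈ with ∈-branches⁻ (insertions m l) (insertions m r) T∈
... | inj₁ (l′ , l′∈ , refl) =
  ↭-trans (prep a (++⁺ʳ (labels r) (insertions-labels m l l′∈))) (swap a m ↭-refl)
... | inj₂ (r′ , r′∈ , refl) =
  ↭-trans (prep a (↭-trans (++⁺ˡ (labels l) (insertions-labels m r r′∈)) (shift m (labels l) (labels r))))
          (swap a m ↭-refl)

insertions-≢ : ∀ m T₀ {T} → T ∈ insertions m T₀ → T ≢ T₀
insertions-≢ m T₀ T∈ refl = <-irrefl (↭-length (insertions-labels m T₀ T∈)) (n<1+n _)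

insertions-unique : ∀ m T₀ → Unique (insertions m T₀)
insertions-unique m empty        = ((λ ()) ∷ []) ∷ [] ∷ []
insertions-unique m (leaf _)     = []
insertions-unique m (node a l r) =
  branches-unique (insertions-unique m l) (insertions-unique m r) (λ r∈ → insertions-≢ m r r∈ refl)

insertions*-unique : ∀ m T₀ → Unique (insertions* m T₀)
insertions*-unique m empty        = [] ∷ []
insertions*-unique m (leaf _)     = []
insertions*-unique m (node a l r) =
  branches-unique (insertions-unique m l) (insertions*-unique m r)
                  (λ r∈ → insertions-≢ m r (insertions*⊆insertions m r r∈) refl)

insertions-increasing : ∀ m T₀ {T} → Increasing T₀ → All (_< m) (labels T₀) → T ∈ insertions m T₀ →
  Increasing T
insertions-increasing m empty _ _ (here refl)         = tt
insertions-increasing m empty _ _ (there (here refl)) = [] , [] , tt , tt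
insertions-increasing m (node a l r) (a<l , a<r , inc-l , inc-r) (a<m ∷ below-m) T∈
  with ∈-branches⁻ (insertions m l) (insertions m r) T∈
... | inj₁ (l′ , l′∈ , refl) =
  All-resp-↭ (↭-sym (insertions-labels m l l′∈)) (a<m ∷ a<l) , a<r ,
  insertions-increasing m l inc-l (++⁻ˡ (labels l) below-m) l′∈ , inc-r
... | inj₂ (r′ , r′∈ , refl) =
  a<l , All-resp-↭ (↭-sym (insertions-labels m r r′∈)) (a<m ∷ a<r) ,
  inc-l , insertions-increasing m r inc-r (++⁻ʳ (labels l) below-m) r′∈

insertions-increasing⁻ : ∀ m T₀ {T} → Increasing T → T ∈ insertions m T₀ → Increasing T₀
insertions-increasing⁻ m empty _ _ = tt
insertions-increasing⁻ m (node a l r) inc T∈ with ∈-branches⁻ (insertions m l) (insertions m r) T∈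
insertions-increasing⁻ m (node a l r) (a<l′ , a<r , inc-l′ , inc-r) _ | inj₁ (l′ , l′∈ , refl)
  with _ ∷ a<l ← All-resp-↭ (insertions-labels m l l′∈) a<l′
  = a<l , a<r , insertions-increasing⁻ m l inc-l′ l′∈ , inc-r
insertions-increasing⁻ m (node a l r) (a<l , a<r′ , inc-l , inc-r′) _ | inj₂ (r′ , r′∈ , refl)
  with _ ∷ a<r ← All-resp-↭ (insertions-labels m r r′∈) a<r′
  = a<l , a<r , inc-l , insertions-increasing⁻ m r inc-r′ r′∈

squeezed-empty : ∀ {a} T → All (a <_) (labels T) → All (_≤ a) (labels T) → T ≡ empty
squeezed-empty empty        _         _         = refl
squeezed-empty (leaf _)     (a<b ∷ _) (b≤a ∷ _) = ⊥-elim (<⇒≱ a<b b≤a)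
squeezed-empty (node _ _ _) (a<b ∷ _) (b≤a ∷ _) = ⊥-elim (<⇒≱ a<b b≤a)

-- In an increasing tree the largest label sits at a leaf or at a node with two empty children.
insertions-complete : ∀ m T → Increasing T → m ∈ labels T → All (_≤ m) (labels T) →
  ∃ λ T₀ → T ∈ insertions m T₀
insertions-complete m (leaf _) _ (here refl) _ = empty , here refl
insertions-complete m (node _ l r) (m<l , m<r , _) (here refl) (_ ∷ ≤m)
  rewrite squeezed-empty l m<l (++⁻ˡ (labels l) ≤m) | squeezed-empty r m<r (++⁻ʳ (labels l) ≤m)
  = empty , there (here refl)
insertions-complete m (node a l r) (_ , _ , inc-l , inc-r) (there m∈) (_ ∷ ≤m) with ∈-++⁻ (labels l) m∈
... | inj₁ m∈l = let l₀ , l∈ = insertions-complete m l inc-l m∈l (++⁻ˡ (labels l) ≤m)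
                 in node a l₀ r , ∈-branchesˡ l∈
... | inj₂ m∈r = let r₀ , r∈ = insertions-complete m r inc-r m∈r (++⁻ʳ (labels l) ≤m)
                 in node a l r₀ , ∈-branchesʳ r∈

insertions*-rightmostEmpty : ∀ m T₀ {T} → RightmostEmpty T₀ → T ∈ insertions* m T₀ → RightmostEmpty T
insertions*-rightmostEmpty m empty _ (here refl) = tt
insertions*-rightmostEmpty m (node a l r) re T∈ with ∈-branches⁻ (insertions m l) (insertions* m r) T∈
... | inj₁ (_ , _ , refl)    = re
... | inj₂ (_ , r′∈ , refl) = insertions*-rightmostEmpty m r re r′∈

insertions-rightmostEmpty⁻ : ∀ m T₀ {T} → T ∈ insertions m T₀ → RightmostEmpty T →
  RightmostEmpty T₀ × T ∈ insertions* m T₀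
insertions-rightmostEmpty⁻ m empty (here refl)         ()
insertions-rightmostEmpty⁻ m empty (there (here refl)) _ = tt , here refl
insertions-rightmostEmpty⁻ m (node a l r) T∈ re with ∈-branches⁻ (insertions m l) (insertions m r) T∈
... | inj₁ (_ , l′∈ , refl) = re , ∈-branchesˡ l′∈
... | inj₂ (_ , r′∈ , refl) = let re₀ , r′∈* = insertions-rightmostEmpty⁻ m r r′∈ re
                              in re₀ , ∈-branchesʳ r′∈*

remove : ℕ → Tree → Tree
remove m empty        = empty
remove m (leaf a)     = if does (a ≟ m) then empty else leaf a
remove m (node a l r) = if does (a ≟ m) then empty else node a (remove m l) (remove m r)

remove-node : ∀ m {a} l r → a ≢ m → remove m (node a l r) ≡ node a (remove m l) (remove m r)
remove-node m {a} l r a≢m rewrite dec-false (a ≟ m) a≢m = refl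

remove-∉ : ∀ m T → m ∉ labels T → remove m T ≡ T
remove-∉ m empty        _   = refl
remove-∉ m (leaf a)     m∉ rewrite dec-false (a ≟ m) (λ { refl → m∉ (here refl) }) = refl
remove-∉ m (node a l r) m∉ = trans (remove-node m l r (λ { refl → m∉ (here refl) }))
  (cong₂ (node a) (remove-∉ m l (m∉ ∘ there ∘ ∈-++⁺ˡ)) (remove-∉ m r (m∉ ∘ there ∘ ∈-++⁺ʳ (labels l))))

remove-insertions : ∀ m T₀ {T} → m ∉ labels T₀ → T ∈ insertions m T₀ → remove m T ≡ T₀
remove-insertions m empty _ (here refl)         rewrite dec-true (m ≟ m) refl = refl
remove-insertions m empty _ (there (here refl)) rewrite dec-true (m ≟ m) refl = refl
remove-insertions m (node a l r) m∉ T∈ with ∈-branches⁻ (insertions m l) (insertions m r) T∈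
... | inj₁ (l′ , l′∈ , refl) = trans (remove-node m l′ r (λ { refl → m∉ (here refl) }))
  (cong₂ (node a) (remove-insertions m l (m∉ ∘ there ∘ ∈-++⁺ˡ) l′∈)
                  (remove-∉ m r (m∉ ∘ there ∘ ∈-++⁺ʳ (labels l))))
... | inj₂ (r′ , r′∈ , refl) = trans (remove-node m l r′ (λ { refl → m∉ (here refl) }))
  (cong₂ (node a) (remove-∉ m l (m∉ ∘ there ∘ ∈-++⁺ˡ))
                  (remove-insertions m r (m∉ ∘ there ∘ ∈-++⁺ʳ (labels l)) r′∈))

concatMap-unique : ∀ {A B : Set} (f : A → List B) {xs} → Unique xs → (∀ x → Unique (f x)) →
  (∀ {x y v} → x ∈ xs → y ∈ xs → v ∈ f x → v ∈ f y → x ≡ y) → Unique (concatMap f xs)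
concatMap-unique f {[]}     _             _   _     = []
concatMap-unique f {x ∷ xs} (x∉xs ∷ xs!) f-! f-inj =
  Unique.++⁺ (f-! x) (concatMap-unique f xs! f-! (λ x∈ y∈ → f-inj (there x∈) (there y∈))) disjoint
  where
  disjoint : ∀ {v} → ¬ (v ∈ f x × v ∈ concatMap f xs)
  disjoint (v∈fx , v∈) with find (∈-concatMap⁻ f v∈)
  ... | y , y∈xs , v∈fy = All.lookup x∉xs y∈xs (f-inj (here refl) (there y∈xs) v∈fx v∈fy)

range-suc : ∀ n → map suc (upTo (suc n)) ↭ suc n ∷ map suc (upTo n)
range-suc n rewrite map-upTo suc (suc n) | map-upTo suc n | sym (applyUpTo-∷ʳ suc n) =
  ↭-sym (∷↭∷ʳ (suc n) (applyUpTo suc n))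

range-bounded : ∀ n → All (_< suc n) (map suc (upTo n))
range-bounded n rewrite map-upTo suc n = applyUpTo⁺₁ suc n s≤s

InT-insertions : ∀ n {T₀ T} → InT n T₀ → T ∈ insertions (suc n) T₀ → InT (suc n) T
InT-insertions n {T₀} (labels↭ , inc) T∈ =
  ↭-trans (insertions-labels (suc n) T₀ T∈) (↭-trans (prep (suc n) labels↭) (↭-sym (range-suc n))) ,
  insertions-increasing (suc n) T₀ inc (All-resp-↭ (↭-sym labels↭) (range-bounded n)) T∈

InT-insertions⁻ : ∀ n {T} → InT (suc n) T → ∃ λ T₀ → InT n T₀ × T ∈ insertions (suc n) T₀
InT-insertions⁻ n {T} (labels↭ , inc) =
  T₀ , (drop-∷ (↭-trans (↭-sym (insertions-labels (suc n) T₀ T∈)) labels↭′) ,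
        insertions-increasing⁻ (suc n) T₀ inc T∈) ,
  T∈
  where
  labels↭′ = ↭-trans labels↭ (range-suc n)
  max∈ = ∈-resp-↭ (↭-sym labels↭′) (here refl)
  ≤max = All-resp-↭ (↭-sym labels↭′) (≤-refl ∷ All.map <⇒≤ (range-bounded n))
  T₀ = proj₁ (insertions-complete (suc n) T inc max∈ ≤max)
  T∈ = proj₂ (insertions-complete (suc n) T inc max∈ ≤max)

insertions-injective : ∀ n {T₀ T₁ T} → InT n T₀ → InT n T₁ →
  T ∈ insertions (suc n) T₀ → T ∈ insertions (suc n) T₁ → T₀ ≡ T₁
insertions-injective n {T₀} {T₁} T₀∈ T₁∈ T∈₀ T∈₁ =
  trans (sym (remove-insertions (suc n) T₀ (fresh T₀∈) T∈₀)) (remove-insertions (suc n) T₁ (fresh T₁∈) T∈₁)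
  where
  fresh : ∀ {T} → InT n T → suc n ∉ labels T
  fresh (labels↭ , _) sn∈ = <-irrefl refl (All.lookup (All-resp-↭ (↭-sym labels↭) (range-bounded n)) sn∈)

InT-zero : ∀ {T} → InT 0 T → T ≡ empty
InT-zero {empty} _ = refl
InT-zero {leaf _} (labels↭ , _) with () ← ↭-empty-inv labels↭
InT-zero {node _ _ _} (labels↭ , _) with () ← ↭-empty-inv labels↭

trees : ℕ → List Tree
trees zero    = empty ∷ []
trees (suc n) = concatMap (insertions (suc n)) (trees n)

trees* : ℕ → List Tree
trees* zero    = empty ∷ []
trees* (suc n) = concatMap (insertions* (suc n)) (trees* n)

trees-sound : ∀ n {T} → T ∈ trees n → InT n T
trees-sound zero    (here refl) = ↭-refl , tt
trees-sound (suc n) T∈ with find (∈-concatMap⁻ (insertions (suc n)) T∈)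
... | T₀ , T₀∈ , T∈′ = InT-insertions n (trees-sound n T₀∈) T∈′

trees-complete : ∀ n {T} → InT n T → T ∈ trees n
trees-complete zero    T∈ rewrite InT-zero T∈ = here refl
trees-complete (suc n) T∈ with InT-insertions⁻ n T∈
... | T₀ , T₀∈ , T∈′ = ∈-concatMap⁺ (insertions (suc n)) (lose (trees-complete n T₀∈) T∈′)

trees-unique : ∀ n → Unique (trees n)
trees-unique zero    = [] ∷ []
trees-unique (suc n) = concatMap-unique (insertions (suc n)) (trees-unique n) (insertions-unique (suc n))
  (λ T₀∈ T₁∈ → insertions-injective n (trees-sound n T₀∈) (trees-sound n T₁∈))

trees-enumerates : ∀ n → Enumerates (trees n) (InT n)
trees-enumerates n = trees-unique n , λ T → mk⇔ (trees-sound n) (trees-complete n)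

trees*-sound : ∀ n {T} → T ∈ trees* n → InT* n T
trees*-sound zero    (here refl) = (↭-refl , tt) , tt
trees*-sound (suc n) T∈ with find (∈-concatMap⁻ (insertions* (suc n)) T∈)
... | T₀ , T₀∈ , T∈′ with trees*-sound n T₀∈
...   | inT , re = InT-insertions n inT (insertions*⊆insertions (suc n) T₀ T∈′) ,
                   insertions*-rightmostEmpty (suc n) T₀ re T∈′

trees*-complete : ∀ n {T} → InT* n T → T ∈ trees* n
trees*-complete zero    (T∈ , _) rewrite InT-zero T∈ = here refl
trees*-complete (suc n) (T∈ , re) with InT-insertions⁻ n T∈
... | T₀ , T₀∈ , T∈′ with insertions-rightmostEmpty⁻ (suc n) T₀ T∈′ re
...   | re₀ , T∈* = ∈-concatMap⁺ (insertions* (suc n)) (lose (trees*-complete n (T₀∈ , re₀)) T∈*)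

trees*-unique : ∀ n → Unique (trees* n)
trees*-unique zero    = [] ∷ []
trees*-unique (suc n) = concatMap-unique (insertions* (suc n)) (trees*-unique n) (insertions*-unique (suc n))
  (λ {T₀} {T₁} T₀∈ T₁∈ T∈₀ T∈₁ →
     insertions-injective n (proj₁ (trees*-sound n T₀∈)) (proj₁ (trees*-sound n T₁∈))
       (insertions*⊆insertions (suc n) T₀ T∈₀) (insertions*⊆insertions (suc n) T₁ T∈₁))

trees*-enumerates : ∀ n → Enumerates (trees* n) (InT* n)
trees*-enumerates n = trees*-unique n , λ T → mk⇔ (trees*-sound n) (trees*-complete n)

polySum-branches : ∀ w a l r xs ys →
  polySum w (branches a l r xs ys) ≗ polySum (λ l′ → w (node a l′ r)) xs ⊕ polySum (λ r′ → w (node a l r′)) ys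
polySum-branches w a l r xs ys k = trans (polySum-++ w (map _ xs) (map _ ys) k)
  (cong₂ _+_ (polySum-map w _ xs k) (polySum-map w _ ys k))

-- Equals emp T ∸ 1 when the rightmost leaf of T is empty, but is additive along the right spine.
emp⁻ : Tree → ℕ
emp⁻ empty        = 0
emp⁻ (leaf _)     = 0
emp⁻ (node _ l r) = emp l + emp⁻ r

emp⁻-rightmostEmpty : ∀ T → RightmostEmpty T → suc (emp⁻ T) ≡ emp T
emp⁻-rightmostEmpty empty        _  = refl
emp⁻-rightmostEmpty (node _ l r) re =
  trans (sym (+-suc (emp l) (emp⁻ r))) (cong (emp l +_) (emp⁻-rightmostEmpty r re))

-- Each of the e empty leaves yields one tree with e ∸ 1 and one with e + 1 empty leaves;
-- the offset c counts the empty leaves outside the subtree, as the recursion into a child requires.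
insertions-weight : ∀ m T₀ c → polySum (λ T → emp T + c) (insertions m T₀) ≗ emp T₀ · spread (emp T₀ + c)
insertions-weight m empty        c k = trans (cong (monomial c k +_) (+-identityʳ _)) (sym (+-identityʳ _))
insertions-weight m (leaf _)     c k = refl
insertions-weight m (node a l r) c k = begin
  polySum (λ T → emp T + c) (insertions m (node a l r)) k
    ≡⟨ polySum-branches (λ T → emp T + c) a l r (insertions m l) (insertions m r) k ⟩
  polySum (λ l′ → emp l′ + er + c) (insertions m l) k + polySum (λ r′ → el + emp r′ + c) (insertions m r) k
    ≡⟨ cong₂ _+_ (polySum-cong (insertions m l) (λ _ → +-assoc _ er c) k)
                 (polySum-cong (insertions m r) (λ _ → xy∙z≈y∙xz el _ c) k) ⟩
  polySum (λ l′ → emp l′ + (er + c)) (insertions m l) k + polySum (λ r′ → emp r′ + (el + c)) (insertions m r) k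
    ≡⟨ cong₂ _+_ (insertions-weight m l (er + c) k) (insertions-weight m r (el + c) k) ⟩
  el * spread (el + (er + c)) k + er * spread (er + (el + c)) k
    ≡⟨ cong₂ (λ u v → el * spread u k + er * spread v k) (sym (+-assoc el er c)) (sym (xy∙z≈y∙xz el er c)) ⟩
  el * spread (el + er + c) k + er * spread (el + er + c) k
    ≡⟨ *-distribʳ-+ (spread (el + er + c) k) el er ⟨
  (el + er) * spread (el + er + c) k ∎
  where
  open ≡-Reasoning
  el = emp l
  er = emp r

insertions*-weight : ∀ m T₀ c → RightmostEmpty T₀ →
  polySum (λ T → emp⁻ T + c) (insertions* m T₀) ≗ emp⁻ T₀ · spread (emp⁻ T₀ + c) ⊕ monomial (suc (emp⁻ T₀ + c))
insertions*-weight m empty        c _  k = +-identityʳ _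
insertions*-weight m (node a l r) c re k = begin
  polySum (λ T → emp⁻ T + c) (insertions* m (node a l r)) k
    ≡⟨ polySum-branches (λ T → emp⁻ T + c) a l r (insertions m l) (insertions* m r) k ⟩
  polySum (λ l′ → emp l′ + er + c) (insertions m l) k + polySum (λ r′ → el + emp⁻ r′ + c) (insertions* m r) k
    ≡⟨ cong₂ _+_ (polySum-cong (insertions m l) (λ _ → +-assoc _ er c) k)
                 (polySum-cong (insertions* m r) (λ _ → xy∙z≈y∙xz el _ c) k) ⟩
  polySum (λ l′ → emp l′ + (er + c)) (insertions m l) k + polySum (λ r′ → emp⁻ r′ + (el + c)) (insertions* m r) k
    ≡⟨ cong₂ _+_ (insertions-weight m l (er + c) k) (insertions*-weight m r (el + c) re k) ⟩
  el * spread (el + (er + c)) k + (er * spread (er + (el + c)) k + monomial (suc (er + (el + c))) k)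
    ≡⟨ cong₂ (λ u v → el * spread u k + (er * spread v k + monomial (suc v) k))
             (sym (+-assoc el er c)) (sym (xy∙z≈y∙xz el er c)) ⟩
  el * spread E k + (er * spread E k + monomial (suc E) k)
    ≡⟨ +-assoc (el * spread E k) _ _ ⟨
  el * spread E k + er * spread E k + monomial (suc E) k
    ≡⟨ cong (_+ monomial (suc E) k) (*-distribʳ-+ (spread E k) el er) ⟨
  (el + er) * spread E k + monomial (suc E) k ∎
  where
  open ≡-Reasoning
  el = emp l
  er = emp⁻ r
  E = el + er + c

insertions-∂tan : ∀ m T₀ → polySum emp (insertions m T₀) ≗ ∂tan (monomial (emp T₀))
insertions-∂tan m T₀ k = begin
  polySum emp (insertions m T₀) k                 ≡⟨ polySum-cong (insertions m T₀) (λ _ → sym (+-identityʳ _)) k ⟩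
  polySum (λ T → emp T + 0) (insertions m T₀) k   ≡⟨ insertions-weight m T₀ 0 k ⟩
  emp T₀ * spread (emp T₀ + 0) k                  ≡⟨ cong (λ e → emp T₀ * spread e k) (+-identityʳ (emp T₀)) ⟩
  emp T₀ * spread (emp T₀) k                      ≡⟨ ∂tan-monomial (emp T₀) k ⟨
  ∂tan (monomial (emp T₀)) k                      ∎
  where open ≡-Reasoning

insertions*-∂sec : ∀ m T₀ → RightmostEmpty T₀ → polySum emp⁻ (insertions* m T₀) ≗ ∂sec (monomial (emp⁻ T₀))
insertions*-∂sec m T₀ re k = begin
  polySum emp⁻ (insertions* m T₀) k                 ≡⟨ polySum-cong (insertions* m T₀) (λ _ → sym (+-identityʳ _)) k ⟩
  polySum (λ T → emp⁻ T + 0) (insertions* m T₀) k   ≡⟨ insertions*-weight m T₀ 0 re k ⟩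
  e * spread (e + 0) k + monomial (suc (e + 0)) k   ≡⟨ cong (λ e′ → e * spread e′ k + monomial (suc e′) k) (+-identityʳ e) ⟩
  e * spread e k + monomial (suc e) k               ≡⟨ ∂sec-monomial e k ⟨
  ∂sec (monomial e) k                               ∎
  where
  open ≡-Reasoning
  e = emp⁻ T₀

P-trees : ∀ n → P n ≗ polySum emp (trees n)
P-trees zero    zero          = refl
P-trees zero    (suc zero)    = refl
P-trees zero    (suc (suc k)) = refl
P-trees (suc n) k = begin
  ∂tan (P n) k                     ≡⟨ resp-≗ ∂tan-additive (P-trees n) k ⟩
  ∂tan (polySum emp (trees n)) k   ≡⟨ polySum-concatMap ∂tan-additive emp emp (insertions (suc n)) (trees n) steps k ⟨
  polySum emp (trees (suc n)) k    ∎
  where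
  open ≡-Reasoning
  steps : All (λ T → polySum emp (insertions (suc n) T) ≗ ∂tan (monomial (emp T))) (trees n)
  steps = All.universal (insertions-∂tan (suc n)) (trees n)

Q-trees : ∀ n → Q n ≗ polySum emp⁻ (trees* n)
Q-trees zero    zero    = refl
Q-trees zero    (suc k) = refl
Q-trees (suc n) k = begin
  ∂sec (Q n) k                       ≡⟨ resp-≗ ∂sec-additive (Q-trees n) k ⟩
  ∂sec (polySum emp⁻ (trees* n)) k   ≡⟨ polySum-concatMap ∂sec-additive emp⁻ emp⁻ (insertions* (suc n)) (trees* n) steps k ⟨
  polySum emp⁻ (trees* (suc n)) k    ∎
  where
  open ≡-Reasoning
  steps : All (λ T → polySum emp⁻ (insertions* (suc n) T) ≗ ∂sec (monomial (emp⁻ T))) (trees* n)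
  steps = All.tabulate (λ {T} T∈ → insertions*-∂sec (suc n) T (proj₂ (trees*-sound n T∈)))

enumerations-↭ : ∀ {xs ys S} → Enumerates xs S → Enumerates ys S → xs ↭ ys
enumerations-↭ (xs! , xs⇔) (ys! , ys⇔) = ∼bag⇒↭ (unique∧set⇒bag xs! ys!
  (λ {T} → mk⇔ (Equivalence.from (ys⇔ T) ∘ Equivalence.to (xs⇔ T))
               (Equivalence.from (xs⇔ T) ∘ Equivalence.to (ys⇔ T))))

theorem4p3 : (n : ℕ) →
    ((∃ λ (xs : List Tree) → Enumerates xs (InT n))
      × (∀ (xs : List Tree) → Enumerates xs (InT n) →
           ∀ k → P n k ≡ polySum emp xs k))
    × ((∃ λ (ys : List Tree) → Enumerates ys (InT* n))
      × (∀ (ys : List Tree) → Enumerates ys (InT* n) →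
           ∀ k → Q n k ≡ polySum (λ T → emp T ∸ 1) ys k))
theorem4p3 n =
  ((trees n , trees-enumerates n) ,
   λ xs xs-enum k → trans (P-trees n k) (polySum-↭ emp (enumerations-↭ (trees-enumerates n) xs-enum) k)) ,
  ((trees* n , trees*-enumerates n) ,
   λ ys ys-enum k → begin
     Q n k                           ≡⟨ Q-trees n k ⟩
     polySum emp⁻ (trees* n) k       ≡⟨ polySum-↭ emp⁻ (enumerations-↭ (trees*-enumerates n) ys-enum) k ⟩
     polySum emp⁻ ys k               ≡⟨ polySum-cong ys (λ {T} T∈ → cong (_∸ 1) (emp⁻-rightmostEmpty T
                                          (proj₂ (Equivalence.to (proj₂ ys-enum T) T∈)))) k ⟩
     polySum (λ T → emp T ∸ 1) ys k  ∎)
  where open ≡-Reasoning
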